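{- Let $\lambda=(m,n)$ be a triangular $2$-partition. Then the triangular Young tableau of $\lambda$ is a row-regular tableau; more precisely, if $n=\lceil m/2\rceil$ it is the maximal row-regular tableau (the $i$-row-regular tableau with $i=m-2(n-1)$), and if $n<\lceil m/2\rceil$ it is the pre-maximal row-regular tableau (the $i$-row-regular tableau with $i=m-2n+1$).
   Context: Partitions are drawn in French convention: cell $(\ell,c)$ ($\ell\ge0$ row from bottom, $c\ge0$ column) belongs to $\lambda$ iff $c<\lambda_{\ell+1}$; a $2$-partition $(m,n)$ has $m\ge n\ge0$. A partition is triangular if there exist positive reals $r,s$ with $\lambda_j=\lfloor r-jr/s\rfloor$ for $1\le j\le s$ and $\lambda_j=0$ for $j>s$. For a cell $c$ of a partition $\mu$, arm $a(c)$ (resp. leg $\ell(c)$) counts cells of $\mu$ strictly right of $c$ in its row (resp. strictly above in its column); $v^-(c,\mu)=\ell(c)/(a(c)+\ell(c)+1)$, $v^+(c,\mu)=(\ell(c)+1)/(a(c)+\ell(c)+1)$; $v^-_\lambda=\max_{c\in\lambda}v^-(c,\lambda)$, $v^+_\lambda=\min_{c\in\lambda}v^+(c,\lambda)$. For a subpartition $\mu\subseteq\lambda$, a cell $c$ of $\mu$ is similar if $v^-(c,\mu)<\frac{v^-_\lambda+v^+_\lambda}{2}\le v^+(c,\mu)$; $(\lambda,\mu)$ is mean-similar if all cells of $\mu$ are similar. The triangular Young tableau of $\lambda$ is the unique standard Young tableau $\theta$ of shape $\lambda$ such that for every $0\le k\le|\lambda|$ the cells with labels $\le k$ form a subpartition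 $\mu$ with $(\lambda,\mu)$ mean-similar. For $1\le i\le m-2(n-1)$, the $i$-row-regular tableau of $(m,n)$ is the standard Young tableau with upper-row labels $n+i,n+i+2,\dots,n+i+2(n-1)$.
   Formalization: The parameters r and s in the definition of a triangular partition range over the positive rationals rather than the positive reals. -}

module Defs where

open import Data.Nat as ℕ using (ℕ; zero; suc; _∸_; _≤_; _<_; _≤?_; _<?_)
open import Data.Integer as ℤ using (ℤ; +_)
open import Data.Rational as ℚ using (ℚ; 0ℚ; 1ℚ; ½; floor; _⊔_; _⊓_; _÷_; >-nonZero)
open import Data.List using (List; []; _∷_; map; upTo; _++_; foldr; filter; length; take)
open import Data.List.Membership.Propositional using (_∈_)
open import Data.List.Relation.Unary.Linked using (Linked)
open import Data.List.Relation.Binary.Pointwise using (Pointwise)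
open import Data.List.Relation.Binary.Permutation.Propositional using (_↭_)
open import Data.Product using (Σ; _×_; _,_; proj₁; proj₂)
open import Relation.Binary.PropositionalEquality using (_≡_)

-- A 2-partition (m , n) (with m ≥ n imposed where needed); also used for
-- its subpartitions (a , b).  Rows are indexed from 0 (French convention:
-- row 0 is the bottom row).
Shape : Set
Shape = ℕ × ℕ

rowLen : Shape → ℕ → ℕ
rowLen (a , b) zero = a
rowLen (a , b) (suc zero) = b
rowLen (a , b) (suc (suc _)) = 0

cells : Shape → List (ℕ × ℕ)
cells (a , b) = map (λ c → (0 , c)) (upTo a) ++ map (λ c → (1 , c)) (upTo b)

arm : Shape → ℕ × ℕ → ℕ
arm μ (ℓ , c) = rowLen μ ℓ ∸ suc c

-- leg: number of cells strictly above (ℓ , c) in column c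
-- (only rows 0 and 1 can be nonempty, so we count rows ℓ' with ℓ < ℓ' ≤ 1)
leg : Shape → ℕ × ℕ → ℕ
leg μ (ℓ , c) =
  length (filter (λ ℓ' → c <? rowLen μ ℓ') (map (λ k → suc ℓ ℕ.+ k) (upTo (2 ∸ suc ℓ))))

vMinus : Shape → ℕ × ℕ → ℚ
vMinus μ x = ℚ._/_ (+ leg μ x) (suc (arm μ x ℕ.+ leg μ x))

vPlus : Shape → ℕ × ℕ → ℚ
vPlus μ x = ℚ._/_ (+ suc (leg μ x)) (suc (arm μ x ℕ.+ leg μ x))

-- v⁻_λ = max over cells of λ (all values are ≥ 0, so 0 is a neutral default)
vMinusMax : Shape → ℚ
vMinusMax λ' = foldr _⊔_ 0ℚ (map (vMinus λ') (cells λ'))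

-- v⁺_λ = min over cells of λ (all values are ≤ 1, so 1 is a neutral default)
vPlusMin : Shape → ℚ
vPlusMin λ' = foldr _⊓_ 1ℚ (map (vPlus λ') (cells λ'))

meanSlope : Shape → ℚ
meanSlope λ' = (vMinusMax λ' ℚ.+ vPlusMin λ') ℚ.* ½

MeanSimilar : Shape → Shape → Set
MeanSimilar λ' μ = ∀ x → x ∈ cells μ →
  (vMinus μ x ℚ.< meanSlope λ') × (meanSlope λ' ℚ.≤ vPlus μ x)

ℕtoℚ : ℕ → ℚ
ℕtoℚ j = ℚ._/_ (+ j) 1

IsTriangularPartition : Shape → Set
IsTriangularPartition λ' =
  Σ ℚ λ r → Σ ℚ λ s → Σ (0ℚ ℚ.< r) λ _ → Σ (0ℚ ℚ.< s) λ s>0 →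
    ∀ j → 1 ≤ j →
      (ℕtoℚ j ℚ.≤ s → + rowLen λ' (j ∸ 1) ≡ floor (r ℚ.- _÷_ (ℕtoℚ j ℚ.* r) s {{>-nonZero s>0}}))
      × (s ℚ.< ℕtoℚ j → rowLen λ' (j ∸ 1) ≡ 0)

-- A tableau of a two-row shape: (labels of row 0 left to right ,
--                                labels of row 1 left to right)
Tableau : Set
Tableau = List ℕ × List ℕ

IsSYT : Shape → Tableau → Set
IsSYT (m , n) (L , U) =
  length L ≡ m × length U ≡ n
  × Linked _<_ L × Linked _<_ U
  × Pointwise _<_ (take n L) U
  × (L ++ U) ↭ map suc (upTo (m ℕ.+ n))

prefixShape : Tableau → ℕ → Shape
prefixShape (L , U) k = length (filter (_≤? k) L) , length (filter (_≤? k) U)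

IsTriangularYoungTableau : Shape → Tableau → Set
IsTriangularYoungTableau (m , n) θ =
  IsSYT (m , n) θ × (∀ k → k ≤ m ℕ.+ n → MeanSimilar (m , n) (prefixShape θ k))

rowRegularUpper : ℕ → ℕ → List ℕ
rowRegularUpper n i = map (λ k → n ℕ.+ i ℕ.+ 2 ℕ.* k) (upTo n)

IsRowRegular : Shape → ℕ → Tableau → Set
IsRowRegular (m , n) i θ =
  1 ≤ i × i ℕ.+ 2 ℕ.* n ≤ m ℕ.+ 2 × IsSYT (m , n) θ × proj₂ θ ≡ rowRegularUpper n i

-- "the triangular Young tableau of λ is the i-row-regular tableau":
-- the i-row-regular tableau exists and is triangular, and every triangular
-- Young tableau of λ is the i-row-regular one.
TriangularIsRowRegular : Shape → ℕ → Set
TriangularIsRowRegular λ' i =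
  Σ Tableau (λ θ → IsRowRegular λ' i θ × IsTriangularYoungTableau λ' θ)
  × (∀ θ → IsTriangularYoungTableau λ' θ → IsRowRegular λ' i θ)

{-# OPTIONS --safe #-}
module Submission where

-- The cells of a two-row shape (a , b) have leg 0 or 1, so a cell with hook length h has
-- (v⁻ , v⁺] equal to (0 , 1/h] or (1/h , 2/h].  Hence, for a slope M in the window
-- (1/(F+1) , 1/F], and for a < 2F and b ≤ F, all cells of (a , b) are similar at M exactly
-- when the shape is balanced: a − b ≤ F, and a − b ≥ F − 1 once b ≥ 1.  Among the shapes of a
-- given size at most one is balanced, so a triangular tableau is determined by how many
-- entries ≤ k its upper row has, for every k, and the row-regular tableau with upper row
-- F + 1 , F + 3 , … has exactly these counts.  Computing v⁻_λ and v⁺_λ case by case shows that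
-- the mean slope of λ lies in the window for F = n + i − 1, where i is the claimed index.

open import Data.Nat using (ℕ; zero; suc; _+_; _*_; _∸_; _≤_; _<_; _≤?_; _<?_; z≤n; s≤s; ⌈_/2⌉; NonZero)
open import Data.Nat.Properties
open import Data.Nat.Tactic.RingSolver using (solve-∀)
open import Data.Integer as ℤ using (+_)
import Data.Integer.Properties as ℤ
open import Data.Rational as ℚ using (ℚ; 0ℚ; 1ℚ; ½; _⊔_; _⊓_; toℚᵘ; fromℚᵘ)
import Data.Rational.Properties as ℚ
open import Data.Rational.Unnormalised as ℚᵘ using (mkℚᵘ; *≤*; *<*)
import Data.Rational.Unnormalised.Properties as ℚᵘ
open import Data.List using (List; []; _∷_; _++_; map; foldr; upTo; applyUpTo; length; filter; take; drop)
open import Data.List.Properties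
  using (++-assoc; filter-++; length-++; length-filter; filter-accept; filter-reject; filter-none; filter-all;
         take++drop≡id; map-upTo)
open import Data.List.Membership.Propositional using (_∈_)
open import Data.List.Membership.Propositional.Properties
  using (∈-++⁻; ∈-++⁺ˡ; ∈-++⁺ʳ; ∈-map⁻; ∈-map⁺; ∈-upTo⁻; ∈-upTo⁺)
open import Data.List.Relation.Unary.Any using (here; there)
open import Data.List.Relation.Unary.All as All using (All; []; _∷_)
import Data.List.Relation.Unary.All.Properties as All
import Data.List.Relation.Unary.AllPairs.Properties as AllPairs
open import Data.List.Relation.Unary.Linked as Linked using (Linked; []; [-]; _∷_)
open import Data.List.Relation.Unary.Linked.Properties using (Linked⇒All; Linked⇒AllPairs; AllPairs⇒Linked)
open import Data.List.Relation.Binary.Pointwise as Pointwise using (Pointwise; []; _∷_)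
open import Data.List.Relation.Binary.Permutation.Propositional
  using (_↭_; prep; swap; ↭-refl; ↭-sym; module PermutationReasoning)
open import Data.List.Relation.Binary.Permutation.Propositional.Properties
  using (filter-↭; ↭-length; shift; ++-comm; ++⁺ˡ; All-resp-↭)
open import Data.Product using (∃; _×_; _,_; proj₁; proj₂)
open import Data.Sum as Sum using (_⊎_; inj₁; inj₂; [_,_]′)
open import Relation.Nullary using (¬_; Dec; yes; no; contradiction)
open import Relation.Binary.Definitions using (tri<; tri≈; tri>)
open import Relation.Binary.PropositionalEquality
  using (_≡_; refl; sym; trans; cong; cong₂; subst; subst₂; module ≡-Reasoning)

open import Defs

count≤ : ℕ → List ℕ → ℕ
count≤ k xs = length (filter (_≤? k) xs)

count≤-accept : ∀ {x} k xs → x ≤ k → count≤ k (x ∷ xs) ≡ suc (count≤ k xs)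
count≤-accept k xs x≤k = cong length (filter-accept (_≤? k) {xs = xs} x≤k)

count≤-reject : ∀ {x} k xs → ¬ x ≤ k → count≤ k (x ∷ xs) ≡ count≤ k xs
count≤-reject k xs x≰k = cong length (filter-reject (_≤? k) {xs = xs} x≰k)

count≤-none : ∀ {k xs} → All (k <_) xs → count≤ k xs ≡ 0
count≤-none {k} k<xs = cong length (filter-none (_≤? k) (All.map <⇒≱ k<xs))

count≤-++ : ∀ k xs ys → count≤ k (xs ++ ys) ≡ count≤ k xs + count≤ k ys
count≤-++ k xs ys = trans (cong length (filter-++ (_≤? k) xs ys)) (length-++ (filter (_≤? k) xs))

count≤-↭ : ∀ k {xs ys} → xs ↭ ys → count≤ k xs ≡ count≤ k ys
count≤-↭ k xs↭ys = ↭-length (filter-↭ (_≤? k) xs↭ys)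

count≤-≤-length : ∀ k xs → count≤ k xs ≤ length xs
count≤-≤-length k = length-filter (_≤? k)

count≤-take : ∀ k n xs → count≤ k (take n xs) ≤ count≤ k xs
count≤-take k n xs = subst (count≤ k (take n xs) ≤_)
  (trans (sym (count≤-++ k (take n xs) (drop n xs))) (cong (count≤ k) (take++drop≡id n xs)))
  (m≤m+n _ _)

count≤-antitone : ∀ k {xs ys} → Pointwise _≤_ xs ys → count≤ k ys ≤ count≤ k xs
count≤-antitone k [] = z≤n
count≤-antitone k (_∷_ {x} {y} {xs} {ys} x≤y xs≤ys) with y ≤? k | x ≤? k
... | yes y≤k | _ = begin
  count≤ k (y ∷ ys)   ≡⟨ count≤-accept k ys y≤k ⟩
  suc (count≤ k ys)   ≤⟨ s≤s (count≤-antitone k xs≤ys) ⟩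
  suc (count≤ k xs)   ≡⟨ count≤-accept k xs (≤-trans x≤y y≤k) ⟨
  count≤ k (x ∷ xs)   ∎
  where open ≤-Reasoning
... | no y≰k | yes x≤k = begin
  count≤ k (y ∷ ys)   ≡⟨ count≤-reject k ys y≰k ⟩
  count≤ k ys         ≤⟨ m≤n⇒m≤1+n (count≤-antitone k xs≤ys) ⟩
  suc (count≤ k xs)   ≡⟨ count≤-accept k xs x≤k ⟨
  count≤ k (x ∷ xs)   ∎
  where open ≤-Reasoning
... | no y≰k | no x≰k = begin
  count≤ k (y ∷ ys)   ≡⟨ count≤-reject k ys y≰k ⟩
  count≤ k ys         ≤⟨ count≤-antitone k xs≤ys ⟩
  count≤ k xs         ≡⟨ count≤-reject k xs x≰k ⟨
  count≤ k (x ∷ xs)   ∎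
  where open ≤-Reasoning

Increasing : List ℕ → Set
Increasing = Linked _<_

increasing-++ : ∀ {xs ys} → Increasing xs → Increasing ys → All (λ x → All (x <_) ys) xs →
                Increasing (xs ++ ys)
increasing-++ ↑xs ↑ys xs<ys =
  AllPairs⇒Linked (AllPairs.++⁺ (Linked⇒AllPairs <-trans ↑xs) (Linked⇒AllPairs <-trans ↑ys) xs<ys)

increasing-≡-by-count≤ : ∀ N {xs ys} → Increasing xs → Increasing ys → All (_≤ N) xs → All (_≤ N) ys →
                         (∀ k → k ≤ N → count≤ k xs ≡ count≤ k ys) → xs ≡ ys
increasing-≡-by-count≤ N {[]} {[]} _ _ _ _ _ = refl
increasing-≡-by-count≤ N {[]} {y ∷ ys} _ _ _ (y≤N ∷ _) same =
  contradiction (trans (same y y≤N) (count≤-accept y ys ≤-refl)) 0≢1+n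
increasing-≡-by-count≤ N {x ∷ xs} {[]} _ _ (x≤N ∷ _) _ same =
  contradiction (trans (sym (same x x≤N)) (count≤-accept x xs ≤-refl)) 0≢1+n
increasing-≡-by-count≤ N {x ∷ xs} {y ∷ ys} ↑xs ↑ys (x≤N ∷ xs≤N) (y≤N ∷ ys≤N) same with <-cmp x y
... | tri< x<y _ _ = contradiction
  (trans (sym (count≤-none (Linked⇒All <-trans x<y ↑ys))) (trans (sym (same x x≤N)) (count≤-accept x xs ≤-refl)))
  0≢1+n
... | tri> _ _ y<x = contradiction
  (trans (sym (count≤-none (Linked⇒All <-trans y<x ↑xs))) (trans (same y y≤N) (count≤-accept y ys ≤-refl)))
  0≢1+n
... | tri≈ _ refl _ = cong (x ∷_) (increasing-≡-by-count≤ N (Linked.tail ↑xs) (Linked.tail ↑ys) xs≤N ys≤N same-tail)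
  where
  same-tail : ∀ k → k ≤ N → count≤ k xs ≡ count≤ k ys
  same-tail k k≤N with x ≤? k
  ... | yes x≤k = suc-injective (trans (sym (count≤-accept k xs x≤k)) (trans (same k k≤N) (count≤-accept k ys x≤k)))
  ... | no x≰k = trans (sym (count≤-reject k xs x≰k)) (trans (same k k≤N) (count≤-reject k ys x≰k))

arithmetic : ℕ → ℕ → ℕ → List ℕ
arithmetic s d zero = []
arithmetic s d (suc t) = d ∷ arithmetic s (s + d) t

interval : ℕ → ℕ → List ℕ
interval = arithmetic 1

applyUpTo-arithmetic : ∀ s d t {f : ℕ → ℕ} → (∀ k → f k ≡ d + s * k) → applyUpTo f t ≡ arithmetic s d t
applyUpTo-arithmetic s d zero f≗ = refl
applyUpTo-arithmetic s d (suc t) f≗ =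
  cong₂ _∷_ (trans (f≗ 0) (trans (cong (λ e → d + e) (*-zeroʳ s)) (+-identityʳ d)))
            (applyUpTo-arithmetic s (s + d) t (λ k → trans (f≗ (suc k)) (shift-start s d k)))
  where
  shift-start : ∀ s d k → d + s * suc k ≡ s + d + s * k
  shift-start = solve-∀

upTo-interval : ∀ N → map suc (upTo N) ≡ interval 1 N
upTo-interval N = trans (map-upTo suc N) (applyUpTo-arithmetic 1 1 N (λ k → cong suc (sym (*-identityˡ k))))

rowRegularUpper-arithmetic : ∀ n i → rowRegularUpper n i ≡ arithmetic 2 (n + i) n
rowRegularUpper-arithmetic n i = trans (map-upTo _ n) (applyUpTo-arithmetic 2 (n + i) n (λ k → refl))

length-arithmetic : ∀ s d t → length (arithmetic s d t) ≡ t
length-arithmetic s d zero = refl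
length-arithmetic s d (suc t) = cong suc (length-arithmetic s (s + d) t)

arithmetic-increasing : ∀ s d t → Increasing (arithmetic (suc s) d t)
arithmetic-increasing s d zero = []
arithmetic-increasing s d (suc zero) = [-]
arithmetic-increasing s d (suc (suc t)) = m<n+m d (s≤s z≤n) ∷ arithmetic-increasing s (suc s + d) (suc t)

arithmetic-≥ : ∀ s d t → All (d ≤_) (arithmetic s d t)
arithmetic-≥ s d zero = []
arithmetic-≥ s d (suc t) = ≤-refl ∷ All.map (≤-trans (m≤n+m d s)) (arithmetic-≥ s (s + d) t)

interval-< : ∀ d t → All (_< d + t) (interval d t)
interval-< d zero = []
interval-< d (suc t) =
  m<m+n d (s≤s z≤n) ∷ All.map (λ p → ≤-trans p (≤-reflexive (sym (+-suc d t)))) (interval-< (suc d) t)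

arithmetic-++ : ∀ s d a b → arithmetic s d a ++ arithmetic s (s * a + d) b ≡ arithmetic s d (a + b)
arithmetic-++ s d zero b = cong (λ e → arithmetic s e b) (cong (_+ d) (*-zeroʳ s))
arithmetic-++ s d (suc a) b = cong (d ∷_)
  (trans (cong (λ e → arithmetic s (s + d) a ++ arithmetic s e b) (one-more s a d)) (arithmetic-++ s (s + d) a b))
  where
  one-more : ∀ s a d → s * suc a + d ≡ s * a + (s + d)
  one-more = solve-∀

interval-++ : ∀ d a b → interval d a ++ interval (d + a) b ≡ interval d (a + b)
interval-++ d a b = subst (λ e → interval d a ++ interval e b ≡ interval d (a + b))
                          (trans (cong (_+ d) (*-identityˡ a)) (+-comm a d)) (arithmetic-++ 1 d a b)

arithmetic-mono : ∀ {s s' d e} t → s ≤ s' → d ≤ e → Pointwise _≤_ (arithmetic s d t) (arithmetic s' e t)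
arithmetic-mono zero _ _ = []
arithmetic-mono (suc t) s≤s' d≤e = d≤e ∷ arithmetic-mono t s≤s' (+-mono-≤ s≤s' d≤e)

take-below-arithmetic : ∀ {s e t n xs} → n ≤ t → Pointwise _≤_ xs (arithmetic s e t) →
                        Pointwise _<_ (take n xs) (arithmetic s (suc e) n)
take-below-arithmetic {n = zero} _ _ = []
take-below-arithmetic {s} {e} {n = suc n} {_ ∷ xs} (s≤s n≤t) (x≤e ∷ xs≤) = s≤s x≤e ∷
  subst (λ d → Pointwise _<_ (take n xs) (arithmetic s d n)) (sym (+-suc s e)) (take-below-arithmetic n≤t xs≤)

count≤-interval : ∀ {k N} → k ≤ N → count≤ k (interval 1 N) ≡ k
count≤-interval {k} {N} k≤N = begin
  count≤ k (interval 1 N)                                       ≡⟨ cong (λ l → count≤ k (interval 1 l)) (m+[n∸m]≡n k≤N) ⟨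
  count≤ k (interval 1 (k + (N ∸ k)))                           ≡⟨ cong (count≤ k) (interval-++ 1 k (N ∸ k)) ⟨
  count≤ k (interval 1 k ++ interval (suc k) (N ∸ k))           ≡⟨ count≤-++ k (interval 1 k) _ ⟩
  count≤ k (interval 1 k) + count≤ k (interval (suc k) (N ∸ k)) ≡⟨ cong₂ _+_ all-below none-below ⟩
  k + 0                                                         ≡⟨ +-identityʳ k ⟩
  k                                                             ∎
  where
  open ≡-Reasoning
  all-below : count≤ k (interval 1 k) ≡ k
  all-below = trans (cong length (filter-all (_≤? k) (All.map ≤-pred (interval-< 1 k)))) (length-arithmetic 1 1 k)
  none-below : count≤ k (interval (suc k) (N ∸ k)) ≡ 0
  none-below = count≤-none (arithmetic-≥ 1 (suc k) (N ∸ k))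

-- What it means for b of the entries F + 1 , F + 3 , … , F + 2n − 1 to be ≤ k: the b-th one,
-- F + 2b − 1, is ≤ k, and the next one, F + 2b + 1, is not (unless b = n).
ProgressionCount : ℕ → ℕ → ℕ → ℕ → Set
ProgressionCount F n k b = (1 ≤ b → b + b + F ≤ suc k) × (k ≤ b + b + F ⊎ b ≡ n)

count≤-progression : ∀ F n k → ProgressionCount F n k (count≤ k (arithmetic 2 (suc F) n))
count≤-progression F zero k = (λ ()) , inj₂ refl
count≤-progression F (suc n) k with suc F ≤? k
... | yes F<k = subst (ProgressionCount F (suc n) k) (sym (count≤-accept k (arithmetic 2 (3 + F) n) F<k))
                      (step (count≤-progression (2 + F) n k))
  where
  two-more : ∀ b F → b + b + (2 + F) ≡ suc b + suc b + F
  two-more = solve-∀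
  step : ∀ {b} → ProgressionCount (2 + F) n k b → ProgressionCount F (suc n) k (suc b)
  step {zero} (_ , below) = (λ _ → s≤s F<k) , Sum.map (subst (k ≤_) (two-more 0 F)) (cong suc) below
  step {suc b} (above , below) = (λ _ → subst (_≤ suc k) (two-more (suc b) F) (above (s≤s z≤n))) ,
                                 Sum.map (subst (k ≤_) (two-more (suc b) F)) (cong suc) below
... | no F≮k = subst (ProgressionCount F (suc n) k)
                     (sym (count≤-none (All.map (<-≤-trans (≰⇒> F≮k)) (arithmetic-≥ 2 (suc F) (suc n)))))
                     ((λ ()) , inj₁ (≤-pred (≰⇒> F≮k)))

interleave-even : ∀ d q → arithmetic 2 (suc d) q ++ arithmetic 2 d q ↭ interval d (q + q)
interleave-even d zero = ↭-refl
interleave-even d (suc q) = begin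
  suc d ∷ (arithmetic 2 (3 + d) q ++ d ∷ arithmetic 2 (2 + d) q) ↭⟨ prep (suc d) (shift d (arithmetic 2 (3 + d) q) _) ⟩
  suc d ∷ d ∷ (arithmetic 2 (3 + d) q ++ arithmetic 2 (2 + d) q) ↭⟨ swap (suc d) d (interleave-even (2 + d) q) ⟩
  d ∷ suc d ∷ interval (2 + d) (q + q)                            ≡⟨ cong (λ l → interval d (suc l)) (+-suc q q) ⟨
  interval d (suc q + suc q)                                      ∎
  where open PermutationReasoning

interleave-odd : ∀ d q → arithmetic 2 (suc d) q ++ arithmetic 2 d (suc q) ↭ interval d (q + suc q)
interleave-odd d q = begin
  arithmetic 2 (suc d) q ++ d ∷ arithmetic 2 (2 + d) q   ↭⟨ shift d (arithmetic 2 (suc d) q) _ ⟩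
  d ∷ (arithmetic 2 (suc d) q ++ arithmetic 2 (2 + d) q) ↭⟨ prep d (++-comm (arithmetic 2 (suc d) q) _) ⟩
  d ∷ (arithmetic 2 (2 + d) q ++ arithmetic 2 (suc d) q) ↭⟨ prep d (interleave-even (suc d) q) ⟩
  interval d (suc (q + q))                               ≡⟨ cong (interval d) (+-suc q q) ⟨
  interval d (q + suc q)                                 ∎
  where open PermutationReasoning

interleave : ∀ {q n} d → n ≡ q ⊎ n ≡ suc q → arithmetic 2 (suc d) q ++ arithmetic 2 d n ↭ interval d (q + n)
interleave {q} d (inj₁ refl) = interleave-even d q
interleave {q} d (inj₂ refl) = interleave-odd d q

syt-count≤-sum : ∀ {m n L U k} → IsSYT (m , n) (L , U) → k ≤ m + n → count≤ k L + count≤ k U ≡ k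
syt-count≤-sum {m} {n} {L} {U} {k} (_ , _ , _ , _ , _ , L++U↭) k≤m+n = begin
  count≤ k L + count≤ k U            ≡⟨ count≤-++ k L U ⟨
  count≤ k (L ++ U)                  ≡⟨ count≤-↭ k L++U↭ ⟩
  count≤ k (map suc (upTo (m + n)))  ≡⟨ cong (count≤ k) (upTo-interval (m + n)) ⟩
  count≤ k (interval 1 (m + n))      ≡⟨ count≤-interval k≤m+n ⟩
  k                                  ∎
  where open ≡-Reasoning

syt-count≤-upper≤lower : ∀ {m n L U} → IsSYT (m , n) (L , U) → ∀ k → count≤ k U ≤ count≤ k L
syt-count≤-upper≤lower {n = n} {L} (_ , _ , _ , _ , L<U , _) k =
  ≤-trans (count≤-antitone k (Pointwise.map <⇒≤ L<U)) (count≤-take k n L)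

syt-upper-≤ : ∀ {m n L U} → IsSYT (m , n) (L , U) → All (_≤ m + n) U
syt-upper-≤ {m} {n} {L} (_ , _ , _ , _ , _ , L++U↭) = All.++⁻ʳ L (All-resp-↭ (↭-sym L++U↭)
  (subst (All (_≤ m + n)) (sym (upTo-interval (m + n))) (All.map ≤-pred (interval-< 1 (m + n)))))

rowRegularTableau : ℕ → ℕ → ℕ → Tableau
rowRegularTableau F q n = interval 1 F ++ arithmetic 2 (2 + F) q , arithmetic 2 (suc F) n

rowRegularTableau-SYT : ∀ {F q n} → 1 ≤ F → n ≡ q ⊎ n ≡ suc q → IsSYT (F + q , n) (rowRegularTableau F q n)
rowRegularTableau-SYT {F} {q} {n} 1≤F n≡q⊎1+q =
  length-lower , length-arithmetic 2 (suc F) n , increasing-lower , arithmetic-increasing 1 (suc F) n ,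
  take-below-arithmetic n≤F+q lower-dominated , permutation
  where
  I P U : List ℕ
  I = interval 1 F
  P = arithmetic 2 (2 + F) q
  U = arithmetic 2 (suc F) n
  length-lower : length (I ++ P) ≡ F + q
  length-lower = trans (length-++ I) (cong₂ _+_ (length-arithmetic 1 1 F) (length-arithmetic 2 (2 + F) q))
  increasing-lower : Increasing (I ++ P)
  increasing-lower = increasing-++ (arithmetic-increasing 0 1 F) (arithmetic-increasing 1 (2 + F) q)
    (All.map (λ x<1+F → All.map (<-trans x<1+F) (arithmetic-≥ 2 (2 + F) q)) (interval-< 1 F))
  n≤F+q : n ≤ F + q
  n≤F+q = [ (λ n≡q → subst (_≤ F + q) (sym n≡q) (m≤n+m q F)) ,
            (λ n≡1+q → subst (_≤ F + q) (sym n≡1+q) (+-monoˡ-≤ q 1≤F)) ]′ n≡q⊎1+q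
  lower-dominated : Pointwise _≤_ (I ++ P) (arithmetic 2 F (F + q))
  lower-dominated = subst (Pointwise _≤_ (I ++ P)) (arithmetic-++ 2 F F q)
    (Pointwise.++⁺ (arithmetic-mono F (s≤s z≤n) 1≤F) (arithmetic-mono q ≤-refl (+-monoˡ-≤ F (*-monoʳ-≤ 2 1≤F))))
  permutation : (I ++ P) ++ U ↭ map suc (upTo (F + q + n))
  permutation = begin
    (I ++ P) ++ U                      ≡⟨ ++-assoc I P U ⟩
    I ++ (P ++ U)                      ↭⟨ ++⁺ˡ I (interleave (suc F) n≡q⊎1+q) ⟩
    I ++ interval (suc F) (q + n)      ≡⟨ interval-++ 1 F (q + n) ⟩
    interval 1 (F + (q + n))           ≡⟨ cong (interval 1) (+-assoc F q n) ⟨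
    interval 1 (F + q + n)             ≡⟨ upTo-interval (F + q + n) ⟨
    map suc (upTo (F + q + n))         ∎
    where open PermutationReasoning

fromℚᵘ-mono-≤ : ∀ {u v} → u ℚᵘ.≤ v → fromℚᵘ u ℚ.≤ fromℚᵘ v
fromℚᵘ-mono-≤ {u} {v} u≤v = ℚ.toℚᵘ-cancel-≤
  (ℚᵘ.≤-respˡ-≃ (ℚᵘ.≃-sym (ℚ.toℚᵘ-fromℚᵘ u))
    (ℚᵘ.≤-respʳ-≃ (ℚᵘ.≃-sym (ℚ.toℚᵘ-fromℚᵘ v)) u≤v))

fromℚᵘ-mono-< : ∀ {u v} → u ℚᵘ.< v → fromℚᵘ u ℚ.< fromℚᵘ v
fromℚᵘ-mono-< {u} {v} u<v = ℚ.toℚᵘ-cancel-<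
  (ℚᵘ.<-respˡ-≃ (ℚᵘ.≃-sym (ℚ.toℚᵘ-fromℚᵘ u))
    (ℚᵘ.<-respʳ-≃ (ℚᵘ.≃-sym (ℚ.toℚᵘ-fromℚᵘ v)) u<v))

*≤*⇒/≤/ : ∀ p x q y .{{_ : NonZero x}} .{{_ : NonZero y}} → p * y ≤ q * x → + p ℚ./ x ℚ.≤ + q ℚ./ y
*≤*⇒/≤/ p (suc x) q (suc y) py≤qx = fromℚᵘ-mono-≤ {mkℚᵘ (+ p) x} {mkℚᵘ (+ q) y}
  (*≤* (subst₂ ℤ._≤_ (ℤ.pos-* p (suc y)) (ℤ.pos-* q (suc x)) (ℤ.+≤+ py≤qx)))

*<*⇒/</ : ∀ p x q y .{{_ : NonZero x}} .{{_ : NonZero y}} → p * y < q * x → + p ℚ./ x ℚ.< + q ℚ./ y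
*<*⇒/</ p (suc x) q (suc y) py<qx = fromℚᵘ-mono-< {mkℚᵘ (+ p) x} {mkℚᵘ (+ q) y}
  (*<* (subst₂ ℤ._<_ (ℤ.pos-* p (suc y)) (ℤ.pos-* q (suc x)) (ℤ.+<+ py<qx)))

0≤/ : ∀ p x .{{_ : NonZero x}} → 0ℚ ℚ.≤ + p ℚ./ x
0≤/ p x = ℚ.nonNegative⁻¹ _ {{ℚ.normalize-nonNeg p x}}

0</ : ∀ p x .{{_ : NonZero p}} .{{_ : NonZero x}} → 0ℚ ℚ.< + p ℚ./ x
0</ p x = ℚ.positive⁻¹ _ {{ℚ.normalize-pos p x}}

mid : ℚ → ℚ → ℚ
mid x y = (x ℚ.+ y) ℚ.* ½

mid-self : ∀ x → mid x x ≡ x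
mid-self x = trans (ℚ.*-distribʳ-+ ½ x x) (trans (sym (ℚ.*-distribˡ-+ x ½ ½)) (ℚ.*-identityʳ x))

mid-≤ʳ : ∀ {x y} → x ℚ.≤ y → mid x y ℚ.≤ y
mid-≤ʳ {x} {y} x≤y = subst (mid x y ℚ.≤_) (mid-self y) (ℚ.*-monoʳ-≤-nonNeg ½ (ℚ.+-monoˡ-≤ y x≤y))

mid->ˡ : ∀ {x y} → x ℚ.< y → x ℚ.< mid x y
mid->ˡ {x} {y} x<y = subst (ℚ._< mid x y) (mid-self x) (ℚ.*-monoˡ-<-pos ½ (ℚ.+-monoʳ-< x x<y))

mid-pos : ∀ {x y} → 0ℚ ℚ.≤ x → 0ℚ ℚ.< y → 0ℚ ℚ.< mid x y
mid-pos 0≤x 0<y = ℚ.*-monoˡ-<-pos ½ (ℚ.+-mono-≤-< 0≤x 0<y)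

mid-/ : ∀ p q x y → mid (+ p ℚ./ suc x) (+ q ℚ./ suc y) ≡ + (p * suc y + q * suc x) ℚ./ (suc x * suc y * 2)
mid-/ p q x y = ℚ.toℚᵘ-injective (begin
  toℚᵘ (mid (+ p ℚ./ suc x) (+ q ℚ./ suc y))
    ≈⟨ ℚ.toℚᵘ-homo-* (+ p ℚ./ suc x ℚ.+ + q ℚ./ suc y) ½ ⟩
  toℚᵘ (+ p ℚ./ suc x ℚ.+ + q ℚ./ suc y) ℚᵘ.* toℚᵘ ½
    ≈⟨ ℚᵘ.*-congʳ (ℚ.toℚᵘ-homo-+ (+ p ℚ./ suc x) (+ q ℚ./ suc y)) ⟩
  (toℚᵘ (+ p ℚ./ suc x) ℚᵘ.+ toℚᵘ (+ q ℚ./ suc y)) ℚᵘ.* toℚᵘ ½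
    ≈⟨ ℚᵘ.*-congʳ (ℚᵘ.+-cong (ℚ.toℚᵘ-fromℚᵘ (mkℚᵘ (+ p) x)) (ℚ.toℚᵘ-fromℚᵘ (mkℚᵘ (+ q) y))) ⟩
  (mkℚᵘ (+ p) x ℚᵘ.+ mkℚᵘ (+ q) y) ℚᵘ.* mkℚᵘ (+ 1) 1
    ≡⟨ cong (λ z → mkℚᵘ z _) numerator ⟩
  mkℚᵘ (+ (p * suc y + q * suc x)) _
    ≈⟨ ℚ.toℚᵘ-fromℚᵘ (mkℚᵘ (+ (p * suc y + q * suc x)) _) ⟨
  toℚᵘ (+ (p * suc y + q * suc x) ℚ./ (suc x * suc y * 2)) ∎)
  where
  open ℚᵘ.≃-Reasoning
  numerator : (+ p ℤ.* + suc y ℤ.+ + q ℤ.* + suc x) ℤ.* + 1 ≡ + (p * suc y + q * suc x)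
  numerator = trans (ℤ.*-identityʳ _)
    (trans (cong₂ ℤ._+_ (sym (ℤ.pos-* p (suc y))) (sym (ℤ.pos-* q (suc x)))) (sym (ℤ.pos-+ (p * suc y) (q * suc x))))

module _ {A : Set} (f : A → ℚ) where

  foldr-⊔-lub : ∀ xs {v} → 0ℚ ℚ.≤ v → (∀ x → x ∈ xs → f x ℚ.≤ v) → foldr _⊔_ 0ℚ (map f xs) ℚ.≤ v
  foldr-⊔-lub [] 0≤v _ = 0≤v
  foldr-⊔-lub (x ∷ xs) 0≤v bound =
    ℚ.⊔-lub (bound x (here refl)) (foldr-⊔-lub xs 0≤v (λ y y∈ → bound y (there y∈)))

  foldr-⊔-ub : ∀ {xs x} → x ∈ xs → f x ℚ.≤ foldr _⊔_ 0ℚ (map f xs)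
  foldr-⊔-ub {x ∷ xs} (here refl) = ℚ.p≤p⊔q (f x) _
  foldr-⊔-ub {y ∷ xs} (there x∈) = ℚ.≤-trans (foldr-⊔-ub x∈) (ℚ.p≤q⊔p (f y) _)

  0≤foldr-⊔ : ∀ xs → 0ℚ ℚ.≤ foldr _⊔_ 0ℚ (map f xs)
  0≤foldr-⊔ [] = ℚ.≤-refl
  0≤foldr-⊔ (x ∷ xs) = ℚ.≤-trans (0≤foldr-⊔ xs) (ℚ.p≤q⊔p (f x) _)

  foldr-⊓-glb : ∀ xs {v} → v ℚ.≤ 1ℚ → (∀ x → x ∈ xs → v ℚ.≤ f x) → v ℚ.≤ foldr _⊓_ 1ℚ (map f xs)
  foldr-⊓-glb [] v≤1 _ = v≤1
  foldr-⊓-glb (x ∷ xs) v≤1 bound =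
    ℚ.⊓-glb (bound x (here refl)) (foldr-⊓-glb xs v≤1 (λ y y∈ → bound y (there y∈)))

  foldr-⊓-lb : ∀ {xs x} → x ∈ xs → foldr _⊓_ 1ℚ (map f xs) ℚ.≤ f x
  foldr-⊓-lb {x ∷ xs} (here refl) = ℚ.p⊓q≤p (f x) _
  foldr-⊓-lb {y ∷ xs} (there x∈) = ℚ.≤-trans (ℚ.p⊓q≤q (f y) _) (foldr-⊓-lb x∈)

-- Hook values of the cells of a two-row shape

cells-ind : ∀ a b (P : ℕ × ℕ → Set) → (∀ {c} → c < a → P (0 , c)) → (∀ {c} → c < b → P (1 , c)) →
            ∀ x → x ∈ cells (a , b) → P x
cells-ind a b P lower upper x x∈ with ∈-++⁻ (map (λ c → (0 , c)) (upTo a)) x∈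
... | inj₁ x∈lower with c , c∈ , refl ← ∈-map⁻ (λ c → (0 , c)) x∈lower = lower (∈-upTo⁻ c∈)
... | inj₂ x∈upper with c , c∈ , refl ← ∈-map⁻ (λ c → (1 , c)) x∈upper = upper (∈-upTo⁻ c∈)

∈-cells-lower : ∀ {a} b {c} → c < a → (0 , c) ∈ cells (a , b)
∈-cells-lower b c<a = ∈-++⁺ˡ (∈-map⁺ (λ c → (0 , c)) (∈-upTo⁺ c<a))

∈-cells-upper : ∀ a {b c} → c < b → (1 , c) ∈ cells (a , b)
∈-cells-upper a c<b = ∈-++⁺ʳ (map (λ c → (0 , c)) (upTo a)) (∈-map⁺ (λ c → (1 , c)) (∈-upTo⁺ c<b))

-- A lower-row cell (0 , c) is covered when the upper row has a cell above it.
leg-covered : ∀ {a b c} → c < b → leg (a , b) (0 , c) ≡ 1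
leg-covered {a} {b} {c} c<b = cong length (filter-accept (λ ℓ → c <? rowLen (a , b) ℓ) {x = 1} {xs = []} c<b)

leg-uncovered : ∀ {a b c} → ¬ c < b → leg (a , b) (0 , c) ≡ 0
leg-uncovered {a} {b} {c} c≮b = cong length (filter-reject (λ ℓ → c <? rowLen (a , b) ℓ) {x = 1} {xs = []} c≮b)

hook-covered : ∀ {a c} → c < a → a ∸ suc c + 1 ≡ a ∸ c
hook-covered {a} {c} c<a = trans (+-comm (a ∸ suc c) 1) (sym (+-∸-assoc 1 c<a))

vMinus-upper : ∀ a b c → vMinus (a , b) (1 , c) ≡ 0ℚ
vMinus-upper a b c = ℚ.0/n≡0 (suc (b ∸ suc c + 0))

vPlus-upper : ∀ a b c → vPlus (a , b) (1 , c) ≡ + 1 ℚ./ suc (b ∸ suc c)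
vPlus-upper a b c = cong (λ h → + 1 ℚ./ suc h) (+-identityʳ (b ∸ suc c))

vMinus-covered : ∀ {a b c} → c < b → c < a → vMinus (a , b) (0 , c) ≡ + 1 ℚ./ suc (a ∸ c)
vMinus-covered {a} c<b c<a rewrite leg-covered {a} c<b = cong (λ h → + 1 ℚ./ suc h) (hook-covered c<a)

vPlus-covered : ∀ {a b c} → c < b → c < a → vPlus (a , b) (0 , c) ≡ + 2 ℚ./ suc (a ∸ c)
vPlus-covered {a} c<b c<a rewrite leg-covered {a} c<b = cong (λ h → + 2 ℚ./ suc h) (hook-covered c<a)

vMinus-uncovered : ∀ {a b c} → ¬ c < b → vMinus (a , b) (0 , c) ≡ 0ℚ
vMinus-uncovered {a} {c = c} c≮b rewrite leg-uncovered {a} c≮b = ℚ.0/n≡0 (suc (a ∸ suc c + 0))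

vPlus-uncovered : ∀ {a b c} → ¬ c < b → vPlus (a , b) (0 , c) ≡ + 1 ℚ./ suc (a ∸ suc c)
vPlus-uncovered {a} {c = c} c≮b rewrite leg-uncovered {a} c≮b =
  cong (λ h → + 1 ℚ./ suc h) (+-identityʳ (a ∸ suc c))

-- Similarity at a given slope

-- The paper's similarity with the mean slope replaced by an arbitrary M, so that
-- MeanSimilar λ μ is AllSimilar (meanSlope λ) μ by definition.
Similar : ℚ → Shape → ℕ × ℕ → Set
Similar M μ x = vMinus μ x ℚ.< M × M ℚ.≤ vPlus μ x

AllSimilar : ℚ → Shape → Set
AllSimilar M μ = ∀ x → x ∈ cells μ → Similar M μ x

similar-by : ∀ {M} μ x {p r} → vMinus μ x ≡ p → vPlus μ x ≡ r → p ℚ.< M → M ℚ.≤ r → Similar M μ x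
similar-by μ x refl refl p<M M≤r = p<M , M≤r

Balanced : ℕ → Shape → Set
Balanced F (a , b) = a ≤ b + F × (1 ≤ b → b + F ≤ suc a)

module _ {F : ℕ} .{{_ : NonZero F}} {M : ℚ} where

  hook-≤ : ∀ h → M ℚ.≤ + 1 ℚ./ F → h < F → M ℚ.≤ + 1 ℚ./ suc h
  hook-≤ h M≤ h<F = ℚ.≤-trans M≤ (*≤*⇒/≤/ 1 F 1 (suc h) (*-monoʳ-≤ 1 h<F))

  hook-2≤ : ∀ h → M ℚ.≤ + 1 ℚ./ F → suc h ≤ 2 * F → M ℚ.≤ + 2 ℚ./ suc h
  hook-2≤ h M≤ h<2F = ℚ.≤-trans M≤ (*≤*⇒/≤/ 1 F 2 (suc h) (subst (_≤ 2 * F) (sym (*-identityˡ (suc h))) h<2F))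

  hook-< : ∀ h → + 1 ℚ./ suc F ℚ.< M → F ≤ h → + 1 ℚ./ suc h ℚ.< M
  hook-< h >M F≤h = ℚ.≤-<-trans (*≤*⇒/≤/ 1 (suc h) 1 (suc F) (*-monoʳ-≤ 1 (s≤s F≤h))) >M

  hook-≤⁻ : ∀ h → + 1 ℚ./ suc F ℚ.< M → M ℚ.≤ + 1 ℚ./ suc h → h < F
  hook-≤⁻ h >M M≤ = ≰⇒> λ F≤h → ℚ.<-irrefl refl (ℚ.<-≤-trans (hook-< h >M F≤h) M≤)

  hook-<⁻ : ∀ h → M ℚ.≤ + 1 ℚ./ F → + 1 ℚ./ suc h ℚ.< M → F ≤ h
  hook-<⁻ h M≤ <M = ≮⇒≥ λ h<F → ℚ.<-irrefl refl (ℚ.<-≤-trans <M (hook-≤ h M≤ h<F))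

  similar-covered : ∀ {a b c} → + 1 ℚ./ suc F ℚ.< M → M ℚ.≤ + 1 ℚ./ F → suc a ≤ 2 * F → b + F ≤ suc a →
                    c < b → c < a → Similar M (a , b) (0 , c)
  similar-covered {a} {b} {c} >M M≤ a<2F b+F≤1+a c<b c<a = similar-by (a , b) (0 , c)
    (vMinus-covered c<b c<a) (vPlus-covered c<b c<a)
    (hook-< (a ∸ c) >M F≤a∸c) (hook-2≤ (a ∸ c) M≤ (≤-trans (s≤s (m∸n≤m a c)) a<2F))
    where
    F≤a∸c : F ≤ a ∸ c
    F≤a∸c = m+n≤o⇒m≤o∸n F (subst (_≤ a) (+-comm c F) (≤-pred (≤-trans (+-monoˡ-≤ F c<b) b+F≤1+a)))

  similar-uncovered : ∀ {a b c} → 0ℚ ℚ.< M → M ℚ.≤ + 1 ℚ./ F → a ≤ b + F → ¬ c < b →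
                      Similar M (a , b) (0 , c)
  similar-uncovered {a} {b} {c} 0<M M≤ a≤b+F c≮b = similar-by (a , b) (0 , c)
    (vMinus-uncovered {a} c≮b) (vPlus-uncovered {a} c≮b) 0<M
    (hook-≤ (a ∸ suc c) M≤ (m<n+o⇒m∸n<o a (suc c) (s≤s (≤-trans a≤b+F (+-monoˡ-≤ F (≮⇒≥ c≮b))))))

  similar-upper : ∀ {a b c} → 0ℚ ℚ.< M → M ℚ.≤ + 1 ℚ./ F → b ≤ F → c < b → Similar M (a , b) (1 , c)
  similar-upper {a} {b} {c} 0<M M≤ b≤F c<b = similar-by (a , b) (1 , c)
    (vMinus-upper a b c) (vPlus-upper a b c) 0<M
    (hook-≤ (b ∸ suc c) M≤ (m<n+o⇒m∸n<o b (suc c) (s≤s (≤-trans b≤F (m≤n+m F c)))))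

  balanced⇒allSimilar : ∀ {a b} → 0ℚ ℚ.< M → M ℚ.≤ + 1 ℚ./ F → (1 ≤ b → + 1 ℚ./ suc F ℚ.< M) →
                        b ≤ F → suc a ≤ 2 * F → Balanced F (a , b) → AllSimilar M (a , b)
  balanced⇒allSimilar {a} {b} 0<M M≤ >M b≤F a<2F (a≤b+F , b+F≤1+a) =
    cells-ind a b (Similar M (a , b)) (λ {c} c<a → lower c<a (c <? b)) (similar-upper {a} 0<M M≤ b≤F)
    where
    lower : ∀ {c} → c < a → Dec (c < b) → Similar M (a , b) (0 , c)
    lower c<a (yes c<b) = similar-covered (>M 1≤b) M≤ a<2F (b+F≤1+a 1≤b) c<b c<a
      where
      1≤b : 1 ≤ b
      1≤b = ≤-trans (s≤s z≤n) c<b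
    lower c<a (no c≮b) = similar-uncovered 0<M M≤ a≤b+F c≮b

  allSimilar⇒≤+F : ∀ {a b} → + 1 ℚ./ suc F ℚ.< M → b ≤ a → AllSimilar M (a , b) → a ≤ b + F
  allSimilar⇒≤+F {a} {b} >M b≤a similar =
    [ strict , (λ b≡a → subst (_≤ b + F) b≡a (m≤m+n b F)) ]′ (m≤n⇒m<n∨m≡n b≤a)
    where
    strict : b < a → a ≤ b + F
    strict b<a = begin
      a                     ≤⟨ m≤n+m∸n a (suc b) ⟩
      suc b + (a ∸ suc b)   ≡⟨ +-suc b (a ∸ suc b) ⟨
      b + suc (a ∸ suc b)   ≤⟨ +-monoʳ-≤ b (hook-≤⁻ (a ∸ suc b) >M M≤hook) ⟩
      b + F                 ∎
      where
      open ≤-Reasoning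
      M≤hook : M ℚ.≤ + 1 ℚ./ suc (a ∸ suc b)
      M≤hook = subst (M ℚ.≤_) (vPlus-uncovered {a} {b} {b} (<-irrefl refl))
                     (proj₂ (similar (0 , b) (∈-cells-lower b b<a)))

  allSimilar⇒+F≤ : ∀ {a b} → M ℚ.≤ + 1 ℚ./ F → b < a → AllSimilar M (a , suc b) → suc b + F ≤ suc a
  allSimilar⇒+F≤ {a} {b} M≤ b<a similar =
    s≤s (subst (_≤ a) (+-comm F b) (m≤o∸n⇒m+n≤o F (<⇒≤ b<a) (hook-<⁻ (a ∸ b) M≤ hook<M)))
    where
    hook<M : + 1 ℚ./ suc (a ∸ b) ℚ.< M
    hook<M = subst (ℚ._< M) (vMinus-covered {a} {suc b} {b} ≤-refl b<a)
                   (proj₁ (similar (0 , b) (∈-cells-lower (suc b) b<a)))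

  allSimilar⇒balanced : ∀ {a b} → M ℚ.≤ + 1 ℚ./ F → + 1 ℚ./ suc F ℚ.< M → b ≤ a →
                        AllSimilar M (a , b) → Balanced F (a , b)
  allSimilar⇒balanced {b = zero} M≤ >M b≤a similar = allSimilar⇒≤+F >M b≤a similar , λ ()
  allSimilar⇒balanced {b = suc b} M≤ >M b≤a similar =
    allSimilar⇒≤+F >M b≤a similar , λ _ → allSimilar⇒+F≤ M≤ b≤a similar

balanced-upper-≤ : ∀ {F a b a' b'} → a + b ≡ a' + b' → Balanced F (a , b) → Balanced F (a' , b') → b' ≤ b
balanced-upper-≤ {F} {a} {b} {a'} {b'} same (a≤b+F , _) (_ , b'+F≤1+a') = ≮⇒≥ λ b<b' → ≤⇒≯ (begin
  suc (suc (b + b + F))   ≡⟨ rearrange₁ b F ⟩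
  suc b + suc b + F       ≤⟨ +-monoˡ-≤ F (+-mono-≤ b<b' b<b') ⟩
  b' + b' + F             ≡⟨ rearrange₂ b' F ⟩
  b' + F + b'             ≤⟨ +-monoˡ-≤ b' (b'+F≤1+a' (≤-trans (s≤s z≤n) b<b')) ⟩
  suc (a' + b')           ≡⟨ cong suc same ⟨
  suc (a + b)             ≤⟨ s≤s (+-monoˡ-≤ b a≤b+F) ⟩
  suc (b + F + b)         ≡⟨ cong suc (rearrange₂ b F) ⟨
  suc (b + b + F)         ∎) (n<1+n (suc (b + b + F)))
  where
  open ≤-Reasoning
  rearrange₁ : ∀ b F → suc (suc (b + b + F)) ≡ suc b + suc b + F
  rearrange₁ = solve-∀
  rearrange₂ : ∀ b F → b + b + F ≡ b + F + b
  rearrange₂ = solve-∀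

balanced-unique : ∀ {F a b a' b'} → a + b ≡ a' + b' → Balanced F (a , b) → Balanced F (a' , b') → b ≡ b'
balanced-unique same bal bal' = ≤-antisym (balanced-upper-≤ (sym same) bal' bal) (balanced-upper-≤ same bal bal')

balanced-by-size : ∀ {F a b} → a + b ≤ b + b + F → (1 ≤ b → b + b + F ≤ suc (a + b)) → Balanced F (a , b)
balanced-by-size {F} {a} {b} ≤upper upper≤ =
  +-cancelʳ-≤ b a (b + F) (subst (a + b ≤_) (rearrange₁ b F) ≤upper) ,
  λ 1≤b → +-cancelˡ-≤ b (b + F) (suc a) (subst₂ _≤_ (+-assoc b b F) (rearrange₂ a b) (upper≤ 1≤b))
  where
  rearrange₁ : ∀ b F → b + b + F ≡ b + F + b
  rearrange₁ = solve-∀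
  rearrange₂ : ∀ a b → suc (a + b) ≡ b + suc a
  rearrange₂ = solve-∀

-- The mean slope of a two-row shape

record SlopeWindow (F : ℕ) .{{_ : NonZero F}} (λ′ : Shape) : Set where
  field
    slope-pos : 0ℚ ℚ.< meanSlope λ′
    slope-≤ : meanSlope λ′ ℚ.≤ + 1 ℚ./ F
    slope-> : 1 ≤ proj₂ λ′ → + 1 ℚ./ suc F ℚ.< meanSlope λ′

slopeWindow : ∀ {F λ′ X Y} .{{_ : NonZero F}} → vMinusMax λ′ ≡ X → vPlusMin λ′ ≡ Y →
              0ℚ ℚ.≤ X → 0ℚ ℚ.< Y → mid X Y ℚ.≤ + 1 ℚ./ F → (1 ≤ proj₂ λ′ → + 1 ℚ./ suc F ℚ.< mid X Y) →
              SlopeWindow F λ′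
slopeWindow refl refl 0≤X 0<Y mid≤ <mid = record { slope-pos = mid-pos 0≤X 0<Y ; slope-≤ = mid≤ ; slope-> = <mid }

vMinusMax-one-row : ∀ m → vMinusMax (m , 0) ≡ 0ℚ
vMinusMax-one-row m = ℚ.≤-antisym
  (foldr-⊔-lub (vMinus (m , 0)) (cells (m , 0)) ℚ.≤-refl
    (cells-ind m 0 (λ x → vMinus (m , 0) x ℚ.≤ 0ℚ)
      (λ {c} _ → ℚ.≤-reflexive (vMinus-uncovered {m} {0} {c} λ ())) λ {_} ()))
  (0≤foldr-⊔ (vMinus (m , 0)) (cells (m , 0)))

vMinusMax-two-rows : ∀ {m n} → n < m → vMinusMax (m , suc n) ≡ + 1 ℚ./ suc (m ∸ n)
vMinusMax-two-rows {m} {n} n<m = ℚ.≤-antisym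
  (foldr-⊔-lub (vMinus (m , suc n)) (cells (m , suc n)) (0≤/ 1 (suc (m ∸ n)))
    (cells-ind m (suc n) (λ x → vMinus (m , suc n) x ℚ.≤ + 1 ℚ./ suc (m ∸ n)) lower upper))
  (subst (ℚ._≤ vMinusMax (m , suc n)) (vMinus-covered ≤-refl n<m)
    (foldr-⊔-ub (vMinus (m , suc n)) (∈-cells-lower (suc n) n<m)))
  where
  lower : ∀ {c} → c < m → vMinus (m , suc n) (0 , c) ℚ.≤ + 1 ℚ./ suc (m ∸ n)
  lower {c} c<m = lower′ (c <? suc n)
    where
    lower′ : Dec (c < suc n) → vMinus (m , suc n) (0 , c) ℚ.≤ + 1 ℚ./ suc (m ∸ n)
    lower′ (yes c≤n) = subst (ℚ._≤ _) (sym (vMinus-covered c≤n c<m))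
      (*≤*⇒/≤/ 1 (suc (m ∸ c)) 1 (suc (m ∸ n)) (*-monoʳ-≤ 1 (s≤s (∸-monoʳ-≤ m (≤-pred c≤n)))))
    lower′ (no c≰n) = subst (ℚ._≤ _) (sym (vMinus-uncovered {m} c≰n)) (0≤/ 1 (suc (m ∸ n)))
  upper : ∀ {c} → c < suc n → vMinus (m , suc n) (1 , c) ℚ.≤ + 1 ℚ./ suc (m ∸ n)
  upper {c} _ = subst (ℚ._≤ _) (sym (vMinus-upper m (suc n) c)) (0≤/ 1 (suc (m ∸ n)))

-- On each run of cells (upper row, covered and uncovered lower cells) v⁺ is smallest at the
-- first cell, (1 , 0), (0 , 0) and (0 , n) respectively.
≤-vPlusMin : ∀ m n {Y} → Y ℚ.≤ 1ℚ → (0 < n → Y ℚ.≤ + 1 ℚ./ suc (n ∸ 1)) →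
             (0 < n → Y ℚ.≤ + 2 ℚ./ suc m) → (n < m → Y ℚ.≤ + 1 ℚ./ suc (m ∸ suc n)) →
             Y ℚ.≤ vPlusMin (m , n)
≤-vPlusMin m n {Y} Y≤1 Y≤upper Y≤covered Y≤uncovered =
  foldr-⊓-glb (vPlus (m , n)) (cells (m , n)) Y≤1 (cells-ind m n (λ x → Y ℚ.≤ vPlus (m , n) x) lower upper)
  where
  lower : ∀ {c} → c < m → Y ℚ.≤ vPlus (m , n) (0 , c)
  lower {c} c<m = lower′ (c <? n)
    where
    lower′ : Dec (c < n) → Y ℚ.≤ vPlus (m , n) (0 , c)
    lower′ (yes c<n) = subst (Y ℚ.≤_) (sym (vPlus-covered c<n c<m))
      (ℚ.≤-trans (Y≤covered (≤-trans (s≤s z≤n) c<n))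
                 (*≤*⇒/≤/ 2 (suc m) 2 (suc (m ∸ c)) (*-monoʳ-≤ 2 (s≤s (m∸n≤m m c)))))
    lower′ (no c≮n) = subst (Y ℚ.≤_) (sym (vPlus-uncovered {m} c≮n))
      (ℚ.≤-trans (Y≤uncovered (≤-<-trans (≮⇒≥ c≮n) c<m))
                 (*≤*⇒/≤/ 1 (suc (m ∸ suc n)) 1 (suc (m ∸ suc c)) (*-monoʳ-≤ 1 (s≤s (∸-monoʳ-≤ m (s≤s (≮⇒≥ c≮n)))))))
  upper : ∀ {c} → c < n → Y ℚ.≤ vPlus (m , n) (1 , c)
  upper {c} c<n = subst (Y ℚ.≤_) (sym (vPlus-upper m n c))
    (ℚ.≤-trans (Y≤upper (≤-trans (s≤s z≤n) c<n))
               (*≤*⇒/≤/ 1 (suc (n ∸ 1)) 1 (suc (n ∸ suc c)) (*-monoʳ-≤ 1 (s≤s (∸-monoʳ-≤ n (s≤s z≤n))))))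

vPlusMin-attained : ∀ λ′ w {Y} → w ∈ cells λ′ → vPlus λ′ w ≡ Y → Y ℚ.≤ vPlusMin λ′ → vPlusMin λ′ ≡ Y
vPlusMin-attained λ′ w w∈ refl Y≤ = ℚ.≤-antisym (foldr-⊓-lb (vPlus λ′) w∈) Y≤

slopeWindow-odd : ∀ t → SlopeWindow (suc t) (suc t + t , suc t)
slopeWindow-odd t =
  slopeWindow vMinusMax≡ vPlusMin≡ (0≤/ 1 (2 + t)) (0</ 1 (suc t)) (mid-≤ʳ (ℚ.<⇒≤ X<Y)) (λ _ → mid->ˡ X<Y)
  where
  m : ℕ
  m = suc t + t
  X<Y : + 1 ℚ./ (2 + t) ℚ.< + 1 ℚ./ suc t
  X<Y = *<*⇒/</ 1 (2 + t) 1 (suc t) (*-monoʳ-< 1 ≤-refl)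
  vMinusMax≡ : vMinusMax (m , suc t) ≡ + 1 ℚ./ (2 + t)
  vMinusMax≡ = trans (vMinusMax-two-rows {m} (m≤m+n (suc t) t)) (cong (λ h → + 1 ℚ./ suc h) (m+n∸n≡m (suc t) t))
  m+1≡2F : ∀ t → 1 * suc (suc t + t) ≡ 2 * suc t
  m+1≡2F = solve-∀
  vPlusMin≡ : vPlusMin (m , suc t) ≡ + 1 ℚ./ suc t
  vPlusMin≡ = vPlusMin-attained (m , suc t) (1 , 0) (∈-cells-upper m (s≤s z≤n)) (vPlus-upper m (suc t) 0)
    (≤-vPlusMin m (suc t) (*≤*⇒/≤/ 1 (suc t) 1 1 (s≤s z≤n)) (λ _ → ℚ.≤-refl)
      (λ _ → *≤*⇒/≤/ 1 (suc t) 2 (suc m) (≤-reflexive (m+1≡2F t)))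
      (λ _ → *≤*⇒/≤/ 1 (suc t) 1 (suc (m ∸ suc (suc t))) (*-monoʳ-≤ 1 (s≤s (m≤n+o⇒m∸n≤o m (suc (suc t)) (n≤1+n m))))))

slopeWindow-even : ∀ t → SlopeWindow (2 + t) (2 + t + t , suc t)
slopeWindow-even t = slopeWindow vMinusMax≡ vPlusMin≡ (0≤/ 1 (3 + t)) (0</ 2 (suc m)) mid≤ (λ _ → mid->ˡ X<Y)
  where
  m : ℕ
  m = 2 + t + t
  X<Y : + 1 ℚ./ (3 + t) ℚ.< + 2 ℚ./ suc m
  X<Y = *<*⇒/</ 1 (3 + t) 2 (suc m) (≤-trans (m≤m+n _ 2) (≤-reflexive (eq t)))
    where
    eq : ∀ t → suc (1 * suc (2 + t + t)) + 2 ≡ 2 * (3 + t)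
    eq = solve-∀
  vMinusMax≡ : vMinusMax (m , suc t) ≡ + 1 ℚ./ (3 + t)
  vMinusMax≡ = trans (vMinusMax-two-rows {m} (s≤s (≤-trans (n≤1+n t) (m≤m+n (suc t) t))))
                     (cong (λ h → + 1 ℚ./ suc h) (m+n∸n≡m (2 + t) t))
  Y≤1/[1+t] : + 2 ℚ./ suc m ℚ.≤ + 1 ℚ./ suc t
  Y≤1/[1+t] = *≤*⇒/≤/ 2 (suc m) 1 (suc t) (≤-trans (n≤1+n _) (≤-reflexive (eq t)))
    where
    eq : ∀ t → suc (2 * suc t) ≡ 1 * suc (2 + t + t)
    eq = solve-∀
  vPlusMin≡ : vPlusMin (m , suc t) ≡ + 2 ℚ./ suc m
  vPlusMin≡ = vPlusMin-attained (m , suc t) (0 , 0) (∈-cells-lower {m} (suc t) (s≤s z≤n))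
    (vPlus-covered {m} {suc t} {0} (s≤s z≤n) (s≤s z≤n))
    (≤-vPlusMin m (suc t) (*≤*⇒/≤/ 2 (suc m) 1 1 (s≤s (s≤s z≤n))) (λ _ → Y≤1/[1+t]) (λ _ → ℚ.≤-refl)
      (λ _ → subst (λ h → + 2 ℚ./ suc m ℚ.≤ + 1 ℚ./ suc h) (sym (m+n∸n≡m t t)) Y≤1/[1+t]))
  mid≤ : mid (+ 1 ℚ./ (3 + t)) (+ 2 ℚ./ suc m) ℚ.≤ + 1 ℚ./ (2 + t)
  mid≤ = subst (ℚ._≤ + 1 ℚ./ (2 + t)) (sym (mid-/ 1 2 (2 + t) m))
    (*≤*⇒/≤/ (1 * suc m + 2 * (3 + t)) ((3 + t) * suc m * 2) 1 (2 + t) (≤-trans (m≤m+n _ t) (≤-reflexive (eq t))))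
    where
    eq : ∀ t → (1 * suc (2 + t + t) + 2 * (3 + t)) * (2 + t) + t ≡ 1 * ((3 + t) * suc (2 + t + t) * 2)
    eq = solve-∀

slopeWindow-short : ∀ {f t} → t < f → SlopeWindow (suc f) (suc f + suc t , suc t)
slopeWindow-short {f} {t} t<f =
  slopeWindow vMinusMax≡ vPlusMin≡ (0≤/ 1 (3 + f)) (0</ 1 (suc f)) (mid-≤ʳ (ℚ.<⇒≤ X<Y)) (λ _ → <mid)
  where
  m : ℕ
  m = suc f + suc t
  X<Y : + 1 ℚ./ (3 + f) ℚ.< + 1 ℚ./ suc f
  X<Y = *<*⇒/</ 1 (3 + f) 1 (suc f) (*-monoʳ-< 1 (s≤s (n≤1+n (suc f))))
  vMinusMax≡ : vMinusMax (m , suc t) ≡ + 1 ℚ./ (3 + f)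
  vMinusMax≡ = trans (vMinusMax-two-rows {m} (m≤n+m (suc t) (suc f)))
    (cong (λ h → + 1 ℚ./ suc h) (trans (cong (_∸ t) (+-suc (suc f) t)) (m+n∸n≡m (2 + f) t)))
  bare-hook : m ∸ suc (suc t) ≡ f
  bare-hook = m+n∸n≡m f (suc t)
  m<2F : 1 * suc m ≤ 2 * suc f
  m<2F = begin
    1 * suc m            ≡⟨ *-identityˡ (suc m) ⟩
    suc (suc f + suc t)  ≤⟨ s≤s (+-monoʳ-≤ (suc f) t<f) ⟩
    suc (suc f + f)      ≡⟨ eq f ⟩
    2 * suc f            ∎
    where
    open ≤-Reasoning
    eq : ∀ f → suc (suc f + f) ≡ 2 * suc f
    eq = solve-∀
  vPlusMin≡ : vPlusMin (m , suc t) ≡ + 1 ℚ./ suc f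
  vPlusMin≡ = vPlusMin-attained (m , suc t) (0 , suc t) (∈-cells-lower {m} (suc t) (s≤s (m≤n+m (suc t) f)))
    (trans (vPlus-uncovered {m} {suc t} {suc t} (<-irrefl refl)) (cong (λ h → + 1 ℚ./ suc h) bare-hook))
    (≤-vPlusMin m (suc t) (*≤*⇒/≤/ 1 (suc f) 1 1 (s≤s z≤n))
      (λ _ → *≤*⇒/≤/ 1 (suc f) 1 (suc t) (*-monoʳ-≤ 1 (s≤s (<⇒≤ t<f))))
      (λ _ → *≤*⇒/≤/ 1 (suc f) 2 (suc m) m<2F)
      (λ _ → ℚ.≤-reflexive (cong (λ h → + 1 ℚ./ suc h) (sym bare-hook))))
  <mid : + 1 ℚ./ (2 + f) ℚ.< mid (+ 1 ℚ./ (3 + f)) (+ 1 ℚ./ suc f)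
  <mid = subst (+ 1 ℚ./ (2 + f) ℚ.<_) (sym (mid-/ 1 1 (2 + f) f))
    (*<*⇒/</ 1 (2 + f) (1 * suc f + 1 * (3 + f)) ((3 + f) * suc f * 2) (≤-trans (m≤m+n _ 1) (≤-reflexive (eq f))))
    where
    eq : ∀ f → suc (1 * ((3 + f) * suc f * 2)) + 1 ≡ (1 * suc f + 1 * (3 + f)) * (2 + f)
    eq = solve-∀

slopeWindow-flat : ∀ f → SlopeWindow (suc f) (suc f + 0 , 0)
slopeWindow-flat f =
  slopeWindow (vMinusMax-one-row (suc f + 0)) vPlusMin≡ ℚ.≤-refl (0</ 1 (suc f)) (mid-≤ʳ (0≤/ 1 (suc f))) λ ()
  where
  hook≡ : suc f + 0 ∸ 1 ≡ f
  hook≡ = +-identityʳ f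
  vPlusMin≡ : vPlusMin (suc f + 0 , 0) ≡ + 1 ℚ./ suc f
  vPlusMin≡ = vPlusMin-attained (suc f + 0 , 0) (0 , 0) (∈-cells-lower {suc f + 0} 0 (s≤s z≤n))
    (trans (vPlus-uncovered {suc f + 0} {0} {0} λ ()) (cong (λ h → + 1 ℚ./ suc h) hook≡))
    (≤-vPlusMin (suc f + 0) 0 (*≤*⇒/≤/ 1 (suc f) 1 1 (s≤s z≤n)) (λ ()) (λ ())
      (λ _ → ℚ.≤-reflexive (cong (λ h → + 1 ℚ./ suc h) (sym hook≡))))

-- Triangular tableaux of two-row shapes

module RowRegularTableau (F q n : ℕ) .{{_ : NonZero F}} (q<F : q < F) (n≡q⊎1+q : n ≡ q ⊎ n ≡ suc q)
                         (window : SlopeWindow F (F + q , n)) where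

  open SlopeWindow window

  θ* : Tableau
  θ* = rowRegularTableau F q n

  syt* : IsSYT (F + q , n) θ*
  syt* = rowRegularTableau-SYT (≤-trans (s≤s z≤n) q<F) n≡q⊎1+q

  q≤n : q ≤ n
  q≤n = [ (λ n≡q → ≤-reflexive (sym n≡q)) , (λ n≡1+q → subst (q ≤_) (sym n≡1+q) (n≤1+n q)) ]′ n≡q⊎1+q

  n≤1+q : n ≤ suc q
  n≤1+q = [ (λ n≡q → subst (_≤ suc q) (sym n≡q) (n≤1+n q)) , ≤-reflexive ]′ n≡q⊎1+q

  n≤F : n ≤ F
  n≤F = ≤-trans n≤1+q q<F

  balanced* : ∀ k → k ≤ F + q + n → Balanced F (prefixShape θ* k)
  balanced* k k≤ = balanced-by-size (subst (_≤ b + b + F) (sym size) k≤b+b+F)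
                                    (λ 1≤b → subst (λ k → b + b + F ≤ suc k) (sym size) (proj₁ profile 1≤b))
    where
    a b : ℕ
    a = count≤ k (proj₁ θ*)
    b = count≤ k (proj₂ θ*)
    size : a + b ≡ k
    size = syt-count≤-sum syt* k≤
    profile : ProgressionCount F n k b
    profile = count≤-progression F n k
    k≤b+b+F : k ≤ b + b + F
    k≤b+b+F = [ (λ k≤ → k≤) , saturated ]′ (proj₂ profile)
      where
      saturated : b ≡ n → k ≤ b + b + F
      saturated b≡n = begin
        k          ≤⟨ k≤ ⟩
        F + q + n  ≤⟨ +-monoˡ-≤ n (+-monoʳ-≤ F q≤n) ⟩
        F + n + n  ≡⟨ rearrange F n ⟩
        n + n + F  ≡⟨ cong (λ c → c + c + F) b≡n ⟨
        b + b + F  ∎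
        where
        open ≤-Reasoning
        rearrange : ∀ F n → F + n + n ≡ n + n + F
        rearrange = solve-∀

  triangular* : IsTriangularYoungTableau (F + q , n) θ*
  triangular* = syt* , λ k k≤ → balanced⇒allSimilar slope-pos slope-≤
    (λ 1≤b → slope-> (≤-trans 1≤b (b≤n k))) (≤-trans (b≤n k) n≤F) (a<2F k) (balanced* k k≤)
    where
    b≤n : ∀ k → count≤ k (proj₂ θ*) ≤ n
    b≤n k = subst (count≤ k (proj₂ θ*) ≤_) (length-arithmetic 2 (suc F) n) (count≤-≤-length k (proj₂ θ*))
    a<2F : ∀ k → suc (count≤ k (proj₁ θ*)) ≤ 2 * F
    a<2F k = begin
      suc (count≤ k (proj₁ θ*))  ≤⟨ s≤s (count≤-≤-length k (proj₁ θ*)) ⟩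
      suc (length (proj₁ θ*))    ≡⟨ cong suc (proj₁ syt*) ⟩
      suc (F + q)                ≤⟨ +-monoʳ-< F q<F ⟩
      F + F                      ≡⟨ cong (λ x → F + x) (+-identityʳ F) ⟨
      2 * F                      ∎
      where open ≤-Reasoning

  triangular⇒upper : ∀ {L U} → IsTriangularYoungTableau (F + q , n) (L , U) → U ≡ proj₂ θ*
  triangular⇒upper {L} {U} (syt , similar) = increasing-≡-by-count≤ (F + q + n)
    (proj₁ (proj₂ (proj₂ (proj₂ syt)))) (arithmetic-increasing 1 (suc F) n) (syt-upper-≤ syt) (syt-upper-≤ syt*)
    (λ k k≤ → same-count k k≤ (1 ≤? n))
    where
    same-count : ∀ k → k ≤ F + q + n → Dec (1 ≤ n) → count≤ k U ≡ count≤ k (proj₂ θ*)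
    same-count k k≤ (yes 1≤n) = balanced-unique (trans (syt-count≤-sum syt k≤) (sym (syt-count≤-sum syt* k≤)))
      (allSimilar⇒balanced slope-≤ (slope-> 1≤n) (syt-count≤-upper≤lower syt k) (similar k k≤)) (balanced* k k≤)
    same-count k k≤ (no 1≰n) = trans (empty U (proj₁ (proj₂ syt))) (sym (empty (proj₂ θ*) (proj₁ (proj₂ syt*))))
      where
      empty : ∀ V → length V ≡ n → count≤ k V ≡ 0
      empty V len = n≤0⇒n≡0 (≤-trans (count≤-≤-length k V) (≤-trans (≤-reflexive len) (≤-pred (≰⇒> 1≰n))))

  rowRegular : ∀ {θ} → IsSYT (F + q , n) θ → proj₂ θ ≡ proj₂ θ* → IsRowRegular (F + q , n) (suc F ∸ n) θ
  rowRegular syt upper = m<n⇒0<n∸m (s≤s n≤F) , index-bound , syt , trans upper (sym upper-eq)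
    where
    upper-eq : rowRegularUpper n (suc F ∸ n) ≡ proj₂ θ*
    upper-eq = trans (rowRegularUpper-arithmetic n (suc F ∸ n))
                     (cong (λ d → arithmetic 2 d n) (m+[n∸m]≡n (m≤n⇒m≤1+n n≤F)))
    index-bound : suc F ∸ n + 2 * n ≤ F + q + 2
    index-bound = begin
      suc F ∸ n + 2 * n    ≡⟨ rearrange (suc F ∸ n) n ⟩
      suc F ∸ n + n + n    ≡⟨ cong (_+ n) (m∸n+n≡m (m≤n⇒m≤1+n n≤F)) ⟩
      suc F + n            ≤⟨ +-monoʳ-≤ (suc F) n≤1+q ⟩
      suc F + suc q        ≡⟨ rearrange′ F q ⟩
      F + q + 2            ∎
      where
      open ≤-Reasoning
      rearrange : ∀ x n → x + 2 * n ≡ x + n + n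
      rearrange = solve-∀
      rearrange′ : ∀ F q → suc F + suc q ≡ F + q + 2
      rearrange′ = solve-∀

  triangularIsRowRegular : TriangularIsRowRegular (F + q , n) (suc F ∸ n)
  triangularIsRowRegular = (θ* , rowRegular syt* refl , triangular*) ,
                           λ { (L , U) triangular → rowRegular (proj₁ triangular) (triangular⇒upper triangular) }

triangularIsRowRegular-empty : TriangularIsRowRegular (0 , 0) 2
triangularIsRowRegular-empty = (([] , []) , (s≤s z≤n , ≤-refl , syt , refl) , syt , λ _ _ _ ()) ,
  λ { (L , U) (syt′ , _) → s≤s z≤n , ≤-refl , syt′ , length≡0⇒[] (proj₁ (proj₂ syt′)) }
  where
  syt : IsSYT (0 , 0) ([] , [])
  syt = refl , refl , [] , [] , [] , ↭-refl
  length≡0⇒[] : ∀ {U : List ℕ} → length U ≡ 0 → U ≡ []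
  length≡0⇒[] {[]} _ = refl

index-maximal : ∀ F q → F + q + 2 ∸ 2 * suc q ≡ suc F ∸ suc q
index-maximal F q = trans (cong₂ _∸_ (eq₁ F q) (eq₂ q)) ([m+n]∸[m+o]≡n∸o (suc q) (suc F) (suc q))
  where
  eq₁ : ∀ F q → F + q + 2 ≡ suc q + suc F
  eq₁ = solve-∀
  eq₂ : ∀ q → 2 * suc q ≡ suc q + suc q
  eq₂ = solve-∀

index-premaximal : ∀ F q → F + q + 1 ∸ 2 * q ≡ suc F ∸ q
index-premaximal F q = trans (cong₂ _∸_ (eq₁ F q) (eq₂ q)) ([m+n]∸[m+o]≡n∸o q (suc F) q)
  where
  eq₁ : ∀ F q → F + q + 1 ≡ q + suc F
  eq₁ = solve-∀
  eq₂ : ∀ q → 2 * q ≡ q + q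
  eq₂ = solve-∀

data EvenOrOdd : ℕ → Set where
  even : ∀ t → EvenOrOdd (t + t)
  odd : ∀ t → EvenOrOdd (suc (t + t))

evenOrOdd : ∀ m → EvenOrOdd m
evenOrOdd zero = even zero
evenOrOdd (suc m) with evenOrOdd m
... | even t = odd t
... | odd t = subst EvenOrOdd (cong suc (+-suc t t)) (even (suc t))

maximal-even : ∀ t → TriangularIsRowRegular (suc t + suc t , suc t) (suc t + suc t + 2 ∸ 2 * suc t)
maximal-even t = subst (λ m → TriangularIsRowRegular (m , suc t) (m + 2 ∸ 2 * suc t)) (cong suc (sym (+-suc t t)))
  (subst (TriangularIsRowRegular (2 + t + t , suc t)) (sym (index-maximal (2 + t) t))
    (RowRegularTableau.triangularIsRowRegular (2 + t) t (suc t) (m≤n⇒m≤1+n (n<1+n t)) (inj₂ refl) (slopeWindow-even t)))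

maximal-odd : ∀ t → TriangularIsRowRegular (suc t + t , suc t) (suc t + t + 2 ∸ 2 * suc t)
maximal-odd t = subst (TriangularIsRowRegular (suc t + t , suc t)) (sym (index-maximal (suc t) t))
  (RowRegularTableau.triangularIsRowRegular (suc t) t (suc t) (n<1+n t) (inj₂ refl) (slopeWindow-odd t))

maximal : ∀ {m} → EvenOrOdd m → TriangularIsRowRegular (m , ⌈ m /2⌉) (m + 2 ∸ 2 * ⌈ m /2⌉)
maximal (even zero) = triangularIsRowRegular-empty
maximal (even (suc t)) = subst (λ n → TriangularIsRowRegular (suc t + suc t , n) (suc t + suc t + 2 ∸ 2 * n))
  (n≡⌈n+n/2⌉ (suc t)) (maximal-even t)
maximal (odd t) = subst (λ n → TriangularIsRowRegular (suc t + t , n) (suc t + t + 2 ∸ 2 * n))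
  (cong suc (n≡⌊n+n/2⌋ t)) (maximal-odd t)

n<⌈m/2⌉⇒n+n<m : ∀ {m n} → EvenOrOdd m → n < ⌈ m /2⌉ → n + n < m
n<⌈m/2⌉⇒n+n<m {n = n} (even t) n<⌈m/2⌉ = +-mono-< n<t n<t
  where
  n<t : n < t
  n<t = subst (n <_) (sym (n≡⌈n+n/2⌉ t)) n<⌈m/2⌉
n<⌈m/2⌉⇒n+n<m {n = n} (odd t) n<⌈m/2⌉ = s≤s (+-mono-≤ n≤t n≤t)
  where
  n≤t : n ≤ t
  n≤t = ≤-pred (subst (n <_) (cong suc (sym (n≡⌊n+n/2⌋ t))) n<⌈m/2⌉)

premaximal-by-excess : ∀ f n → n ≤ f → TriangularIsRowRegular (suc f + n , n) (suc f + n + 1 ∸ 2 * n)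
premaximal-by-excess f zero _ = subst (TriangularIsRowRegular (suc f + 0 , 0)) (sym (index-premaximal (suc f) 0))
  (RowRegularTableau.triangularIsRowRegular (suc f) 0 0 (s≤s z≤n) (inj₁ refl) (slopeWindow-flat f))
premaximal-by-excess f (suc t) t<f =
  subst (TriangularIsRowRegular (suc f + suc t , suc t)) (sym (index-premaximal (suc f) (suc t)))
    (RowRegularTableau.triangularIsRowRegular (suc f) (suc t) (suc t) (s≤s t<f) (inj₁ refl) (slopeWindow-short t<f))

premaximal : ∀ m n → n < ⌈ m /2⌉ → TriangularIsRowRegular (m , n) (m + 1 ∸ 2 * n)
premaximal m n n<⌈m/2⌉ = subst (λ m → TriangularIsRowRegular (m , n) (m + 1 ∸ 2 * n)) (trans (eq n o) m≡)
  (premaximal-by-excess (n + o) n (m≤m+n n o))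
  where
  split : ∃ λ o → suc (n + n) + o ≡ m
  split = m≤n⇒∃[o]m+o≡n (n<⌈m/2⌉⇒n+n<m (evenOrOdd m) n<⌈m/2⌉)
  o : ℕ
  o = proj₁ split
  m≡ : suc (n + n) + o ≡ m
  m≡ = proj₂ split
  eq : ∀ n o → suc (n + o) + n ≡ suc (n + n) + o
  eq = solve-∀

-- Neither n ≤ m nor the triangularity of λ is needed: each case hypothesis alone places the
-- mean slope in the right window.
proposition4p8 : (m n : ℕ) → n ≤ m → IsTriangularPartition (m , n) →
    (n ≡ ⌈ m /2⌉ → TriangularIsRowRegular (m , n) (m + 2 ∸ 2 * n))
    × (n < ⌈ m /2⌉ → TriangularIsRowRegular (m , n) (m + 1 ∸ 2 * n))
proposition4p8 m n _ _ = (λ { refl → maximal (evenOrOdd m) }) , premaximal m n
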